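{- For every odd integer $q>4$, $$N(4,q)=\frac18(q^2+4q+3)+\Big(\Big\lfloor\frac{q-1}{6}\Big\rfloor+1\Big)\Big(\frac{q-1}{2}-\frac32\Big\lfloor\frac{q-1}{6}\Big\rfloor\Big)+N(4,q-4),$$ and for every odd integer $q\ge7$, $$\mathrm{Psym}(4,q)=\mathrm{Psym}(4,q-4)+2.$$
   Context: A numerical semigroup is an additive submonoid $H\subseteq\mathbb N=\{0,1,\dots\}$ with finite complement; $g(H)=|\mathbb N\setminus H|$ and $F(H)$ is the largest integer not in $H$; $H$ is pseudo-symmetric if $2g(H)=F(H)+2$. For $q$ odd, $N(4,q)$ is the number of numerical semigroups containing $4$ and $q$, and $\mathrm{Psym}(4,q)$ the number of pseudo-symmetric ones among them. -}

module Defs where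

open import Data.Nat using (ℕ; zero; suc; _+_; _*_; _<_)
open import Data.Integer using (ℤ; +_; -[1+_])
open import Data.Bool using (Bool; true; false; if_then_else_)
open import Data.Maybe using (Maybe; just; nothing; maybe)
open import Data.List using (List; []; _∷_; length)
open import Data.Vec using (Vec; toList)
open import Data.Product using (Σ; ∃; _×_)
open import Data.List.Relation.Unary.Unique.Propositional using (Unique)
open import Data.List.Membership.Propositional using (_∈_)
open import Function.Bundles using (_⇔_)
open import Relation.Binary.PropositionalEquality using (_≡_)

Subsetℕ : Set
Subsetℕ = ℕ → Bool

_∈ℕ_ : ℕ → Subsetℕ → Set
n ∈ℕ H = H n ≡ true

IsNumericalSemigroup : Subsetℕ → Set
IsNumericalSemigroup H =
  (0 ∈ℕ H)
  × (∀ a b → a ∈ℕ H → b ∈ℕ H → (a + b) ∈ℕ H)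
  × (∃ λ F → ∀ n → F < n → n ∈ℕ H)

setOf : List Bool → Subsetℕ
setOf [] n = true
setOf (b ∷ bs) zero = b
setOf (b ∷ bs) (suc n) = setOf bs n

-- Every numerical semigroup containing 4 and q (q odd) contains every
-- n ≥ 3q (the Frobenius number of ⟨4,q⟩ is 3q-4), so such semigroups are
-- exactly the sets  setOf (toList v)  for v : Vec Bool (3 * q)  (bijectively).
Bound : ℕ → ℕ
Bound q = 3 * q

Code : ℕ → Set
Code q = Vec Bool (Bound q)

semigroupOf : (q : ℕ) → Code q → Subsetℕ
semigroupOf q v = setOf (toList v)

IsNS4q : (q : ℕ) → Code q → Set
IsNS4q q v = IsNumericalSemigroup (semigroupOf q v) × (4 ∈ℕ semigroupOf q v) × (q ∈ℕ semigroupOf q v)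

-- genus: number of gaps (all gaps lie below the length of the list)
countFalse : List Bool → ℕ
countFalse [] = 0
countFalse (true ∷ bs) = countFalse bs
countFalse (false ∷ bs) = suc (countFalse bs)

genus : (q : ℕ) → Code q → ℕ
genus q v = countFalse (toList v)

lastGap : List Bool → Maybe ℕ
lastGap [] = nothing
lastGap (b ∷ bs) with lastGap bs
... | just k = just (suc k)
... | nothing = if b then nothing else just 0

-- Frobenius number: largest integer not in H (= -1 when H = ℕ).
frobenius : (q : ℕ) → Code q → ℤ
frobenius q v = maybe +_ -[1+ 0 ] (lastGap (toList v))

IsPseudoSymmetric : (q : ℕ) → Code q → Set
IsPseudoSymmetric q v = Data.Integer._*_ (+ 2) (+ genus q v) ≡ Data.Integer._+_ (frobenius q v) (+ 2)
  where import Data.Integer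

HasCount : {A : Set} → (A → Set) → ℕ → Set
HasCount {A} P n = Σ (List A) λ xs → Unique xs × (∀ v → (v ∈ xs) ⇔ P v) × (length xs ≡ n)

IsN4 : ℕ → ℕ → Set
IsN4 q n = HasCount (IsNS4q q) n

IsPsym4 : ℕ → ℕ → Set
IsPsym4 q n = HasCount (λ (v : Code q) → IsNS4q q v × IsPseudoSymmetric q v) n

-- A numerical semigroup H ∋ 4 is determined by its Kunz coordinates (x₁, x₂, x₃): its Apéry set
-- with respect to 4 is {0, 4x₁ + 1, 4x₂ + 2, 4x₃ + 3}, and the admissible coordinates are the lattice
-- points of the Kunz polytope x₂ ≤ 2x₁, x₂ ≤ 2x₃ + 1, x₃ ≤ x₁ + x₂, x₁ ≤ x₂ + x₃ + 1.  For odd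
-- q = 4k + ρ, q ∈ H means x_ρ ≤ k, so N(4,q) − N(4,q−4) counts the lattice points of the slice x_ρ = k.
-- Its rows (fixed x₂) are intervals; dropping one of their two lower bounds turns the slice into a
-- trapezoid, and the discarded part is a triangle that grows by a linear amount when k increases by 3.
-- Hence the count changes linearly under k ↦ k + 3, as the right-hand side does under q ↦ q + 12, and
-- three base cases are settled by evaluation.  For pseudo-symmetry, the genus is x₁ + x₂ + x₃, and
-- 2g = F + 2 forces by parity F = 4x₂ − 2 and then x₂ = x₁ + x₃ with x₁ ≥ 1.  Together with the Kunz
-- inequalities only (s+1, 2s+1, s) and (s+1, 2s+2, s+1) remain, and each new slice contains two of them.
module Submission where

open import Defs
open import Data.Nat using (ℕ; _+_; _*_; _∸_; _/_; _%_; _<_; _≤_)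
open import Data.Product using (∃₂; _×_)
open import Relation.Binary.PropositionalEquality using (_≡_)

open import Data.Bool using (Bool; true; false)
open import Data.Bool.Properties using (T-≡; ⇔→≡; ¬-not)
open import Data.Empty using (⊥; ⊥-elim)
import Data.Integer as ℤ
import Data.Integer.Properties as ℤₚ
open import Data.List using (List; []; _∷_; _++_; map)
open import Data.List.Membership.Propositional using (_∈_)
open import Data.List.Membership.Propositional.Properties using (∈-map⁺; ∈-map⁻; ∈-++⁺ˡ; ∈-++⁺ʳ; ∈-++⁻)
open import Data.List.Properties using (length-map; length-++)
open import Data.List.Relation.Unary.All as All using (All; []; _∷_)
import Data.List.Relation.Unary.All.Properties as All
open import Data.List.Relation.Unary.Any using (here; there)
open import Data.List.Relation.Unary.Unique.Propositional using (Unique; []; _∷_)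
import Data.List.Relation.Unary.Unique.Propositional.Properties as Unique
open import Data.Maybe using (Maybe; just; nothing; maybe)
open import Data.Nat.Base
  using (zero; suc; pred; z≤n; s≤s; s≤s⁻¹; _≤ᵇ_; _⊔_; _⊓_; ⌊_/2⌋; ⌈_/2⌉; _≤′_; ≤′-refl; ≤′-step)
open import Data.Nat.DivMod using (+-distrib-/-∣ˡ; m/n*n≤m; m≡m%n+[m/n]*n; m%n<n; [m+kn]%n≡m%n)
open import Data.Nat.Divisibility using (divides)
open import Data.Nat.Properties
open import Data.Nat.Tactic.RingSolver using (solve-∀)
open import Data.Product using (∃; _,_; proj₁; proj₂)
open import Data.Sum as Sum using (_⊎_; inj₁; inj₂; [_,_])
open import Data.Unit using (tt)
open import Data.Vec using (Vec; toList; []; _∷_)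
open import Function using (_∘_)
open import Function.Bundles using (_⇔_; mk⇔; Equivalence)
import Function.Properties.Equivalence as ⇔
open import Relation.Binary.Definitions using (tri<; tri≈; tri>)
open import Relation.Binary.PropositionalEquality using (_≢_; refl; sym; trans; cong; cong₂; subst; module ≡-Reasoning)
open import Relation.Nullary using (¬_; contradiction)

open Equivalence using (to; from)

∑< : ℕ → (ℕ → ℕ) → ℕ
∑< zero    f = 0
∑< (suc n) f = ∑< n f + f n

syntax ∑< n (λ j → e) = ∑[ j < n ] e

∑<-cong : ∀ n {f g : ℕ → ℕ} → (∀ j → f j ≡ g j) → ∑< n f ≡ ∑< n g
∑<-cong zero    f≗g = refl
∑<-cong (suc n) f≗g = cong₂ _+_ (∑<-cong n f≗g) (f≗g n)

∑<-+ : ∀ n (f g : ℕ → ℕ) → ∑[ j < n ] (f j + g j) ≡ ∑< n f + ∑< n g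
∑<-+ zero    f g = refl
∑<-+ (suc n) f g = trans (cong (_+ (f n + g n)) (∑<-+ n f g)) (interchange (∑< n f) (∑< n g) (f n) (g n))
  where
  interchange : ∀ a b c d → a + b + (c + d) ≡ a + c + (b + d)
  interchange = solve-∀

∑<-const+ : ∀ n c (f : ℕ → ℕ) → ∑[ j < n ] (c + f j) ≡ n * c + ∑< n f
∑<-const+ n c f = trans (∑<-+ n (λ _ → c) f) (cong (_+ ∑< n f) (∑<-const n))
  where
  ∑<-const : ∀ n → ∑[ j < n ] c ≡ n * c
  ∑<-const zero    = refl
  ∑<-const (suc n) = trans (cong (_+ c) (∑<-const n)) (+-comm (n * c) c)

∑<-head : ∀ n (f : ℕ → ℕ) → ∑< (suc n) f ≡ f 0 + ∑[ j < n ] f (suc j)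
∑<-head zero    f = +-comm 0 (f 0)
∑<-head (suc n) f = trans (cong (_+ f (suc n)) (∑<-head n f)) (+-assoc (f 0) _ _)

∑<-vanishing : ∀ {m n} (f : ℕ → ℕ) → (∀ j → m ≤ j → f j ≡ 0) → m ≤′ n → ∑< n f ≡ ∑< m f
∑<-vanishing f f≡0 ≤′-refl = refl
∑<-vanishing {m} {suc n} f f≡0 (≤′-step m≤′n) = begin
  ∑< n f + f n  ≡⟨ cong₂ _+_ (∑<-vanishing f f≡0 m≤′n) (f≡0 n (≤′⇒≤ m≤′n)) ⟩
  ∑< m f + 0    ≡⟨ +-identityʳ _ ⟩
  ∑< m f        ∎
  where open ≡-Reasoning

∑<-⌈n/2⌉ : ∀ K → ∑[ j < suc (K + K) ] ⌈ j /2⌉ ≡ K * K + K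
∑<-⌈n/2⌉ zero    = refl
∑<-⌈n/2⌉ (suc K) = begin
  ∑[ j < suc (suc K + suc K) ] ⌈ j /2⌉
    ≡⟨ cong (λ n → ∑[ j < suc (suc n) ] ⌈ j /2⌉) (+-suc K K) ⟩
  ∑[ j < suc (K + K) ] ⌈ j /2⌉ + ⌈ suc (K + K) /2⌉ + ⌈ suc (suc (K + K)) /2⌉
    ≡⟨ cong₂ _+_ (cong₂ _+_ (∑<-⌈n/2⌉ K) (cong suc (sym (n≡⌊n+n/2⌋ K))))
                 (cong suc (sym (n≡⌈n+n/2⌉ K))) ⟩
  K * K + K + suc K + suc K
    ≡⟨ square K ⟩
  suc K * suc K + suc K
    ∎
  where
  open ≡-Reasoning
  square : ∀ K → K * K + K + suc K + suc K ≡ suc K * suc K + suc K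
  square = solve-∀

∑<-⌊n/2⌋ : ∀ K → ∑[ j < suc (suc (K + K)) ] ⌊ j /2⌋ ≡ K * K + K
∑<-⌊n/2⌋ K = trans (∑<-head (suc (K + K)) ⌊_/2⌋) (∑<-⌈n/2⌉ K)

∸-⊔-split : ∀ {m a b} → a ≤ m → b ≤ m → m ∸ (a ⊔ b) + (b ∸ a) ≡ m ∸ a
∸-⊔-split {m} {a} {b} a≤m b≤m with ≤-total a b
... | inj₂ b≤a rewrite m≥n⇒m⊔n≡m b≤a | m≤n⇒m∸n≡0 b≤a = +-identityʳ (m ∸ a)
... | inj₁ a≤b rewrite m≤n⇒m⊔n≡n a≤b = +-cancelʳ-≡ a _ _ (begin
  m ∸ b + (b ∸ a) + a  ≡⟨ +-assoc (m ∸ b) _ a ⟩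
  m ∸ b + (b ∸ a + a)  ≡⟨ cong (m ∸ b +_) (m∸n+n≡m a≤b) ⟩
  m ∸ b + b            ≡⟨ m∸n+n≡m b≤m ⟩
  m                    ≡⟨ m∸n+n≡m a≤m ⟨
  m ∸ a + a            ∎)
  where open ≡-Reasoning

∑<-∸-⊔ : ∀ n (m a b : ℕ → ℕ) → (∀ j → a j ≤ m j) → (∀ j → b j ≤ m j) →
         ∑[ j < n ] (m j ∸ (a j ⊔ b j)) + ∑[ j < n ] (b j ∸ a j) ≡ ∑[ j < n ] (m j ∸ a j)
∑<-∸-⊔ n m a b a≤m b≤m = trans (sym (∑<-+ n _ _)) (∑<-cong n (λ j → ∸-⊔-split (a≤m j) (b≤m j)))

triangle : (ℕ → ℕ) → ℕ → ℕ
triangle f K = ∑[ j < K ] (K ∸ f j)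

module _ (f : ℕ → ℕ) (j≤f : ∀ j → j ≤ f j) where

  triangle-∑< : ∀ {K n} → K ≤ n → ∑[ j < n ] (K ∸ f j) ≡ triangle f K
  triangle-∑< K≤n = ∑<-vanishing _ (λ j K≤j → m≤n⇒m∸n≡0 (≤-trans K≤j (j≤f j))) (≤⇒≤′ K≤n)

  triangle-step : (∀ j → f (2 + j) ≡ 3 + f j) → ∀ K →
                  triangle f (3 + K) ≡ triangle f K + ((3 + K ∸ f 0) + (3 + K ∸ f 1))
  triangle-step f-step K = begin
    triangle f (3 + K)                                     ≡⟨ ∑<-head (2 + K) _ ⟩
    a + ∑[ j < 2 + K ] (3 + K ∸ f (1 + j))                 ≡⟨ cong (a +_) (∑<-head (1 + K) _) ⟩
    a + (b + ∑[ j < 1 + K ] (3 + K ∸ f (2 + j)))           ≡⟨ cong (λ t → a + (b + t)) shifted ⟩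
    a + (b + triangle f K)                                 ≡⟨ sym (+-assoc a b (triangle f K)) ⟩
    a + b + triangle f K                                   ≡⟨ +-comm (a + b) (triangle f K) ⟩
    triangle f K + (a + b)                                 ∎
    where
    open ≡-Reasoning
    a b : ℕ
    a = 3 + K ∸ f 0
    b = 3 + K ∸ f 1
    shifted : ∑[ j < 1 + K ] (3 + K ∸ f (2 + j)) ≡ triangle f K
    shifted = trans (∑<-cong (1 + K) (λ j → cong (3 + K ∸_) (f-step j))) (triangle-∑< (n≤1+n K))

cancel-complement : ∀ d t s δ {d′ p p′} →
                    d + t ≡ p → d′ + (t + s) ≡ p′ → p′ ≡ p + (s + δ) → d′ ≡ d + δ
cancel-complement d t s δ {d′} {p} {p′} d+t≡p d′+t+s≡p′ p′≡p+s+δ = +-cancelʳ-≡ (t + s) d′ (d + δ) (begin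
  d′ + (t + s)     ≡⟨ d′+t+s≡p′ ⟩
  p′               ≡⟨ p′≡p+s+δ ⟩
  p + (s + δ)      ≡⟨ cong (_+ (s + δ)) (sym d+t≡p) ⟩
  d + t + (s + δ)  ≡⟨ shuffle d t s δ ⟩
  d + δ + (t + s)  ∎)
  where
  open ≡-Reasoning
  shuffle : ∀ d t s δ → d + t + (s + δ) ≡ d + δ + (t + s)
  shuffle = solve-∀

⌊n/2⌋≤m⇔n≤1+m+m : ∀ n m → ⌊ n /2⌋ ≤ m ⇔ n ≤ suc (m + m)
⌊n/2⌋≤m⇔n≤1+m+m n m =
  mk⇔ (⇒ n m) (λ n≤1+m+m → subst (⌊ n /2⌋ ≤_) (sym (n≡⌈n+n/2⌉ m)) (⌊n/2⌋-mono n≤1+m+m))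
  where
  ⇒ : ∀ n m → ⌊ n /2⌋ ≤ m → n ≤ suc (m + m)
  ⇒ zero          m       _        = z≤n
  ⇒ (suc zero)    m       _        = s≤s z≤n
  ⇒ (suc (suc n)) (suc m) (s≤s le) = s≤s (s≤s (≤-trans (⇒ n m le) (≤-reflexive (sym (+-suc m m)))))

⌈n/2⌉≤m⇔n≤m+m : ∀ n m → ⌈ n /2⌉ ≤ m ⇔ n ≤ m + m
⌈n/2⌉≤m⇔n≤m+m n m = ⇔.trans (⌊n/2⌋≤m⇔n≤1+m+m (suc n) m) (mk⇔ s≤s⁻¹ s≤s)

+-∸-⌊n/2⌋ : ∀ c n → c + n ∸ ⌊ n /2⌋ ≡ c + ⌈ n /2⌉
+-∸-⌊n/2⌋ c n = trans (+-∸-assoc c (⌊n/2⌋≤n n))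
  (cong (c +_) (trans (cong (_∸ ⌊ n /2⌋) (sym (⌊n/2⌋+⌈n/2⌉≡n n))) (m+n∸m≡n ⌊ n /2⌋ ⌈ n /2⌉)))

+-∸-⌈n/2⌉ : ∀ c n → c + n ∸ ⌈ n /2⌉ ≡ c + ⌊ n /2⌋
+-∸-⌈n/2⌉ c n = trans (+-∸-assoc c (⌈n/2⌉≤n n))
  (cong (c +_) (trans (cong (_∸ ⌈ n /2⌉) (sym (⌊n/2⌋+⌈n/2⌉≡n n))) (m+n∸n≡m ⌊ n /2⌋ ⌈ n /2⌉)))

quadratic : ℕ → ℕ
quadratic q = q * q + 4 * q + 3

-- 8 · (N(4,q) − N(4,q−4)), as given by the theorem.
Δ₈ : ℕ → ℕ
Δ₈ q = quadratic q + 4 * (((q ∸ 1) / 6) + 1) * ((q ∸ 1) ∸ 3 * ((q ∸ 1) / 6))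

-- Writing q − 1 = 3d + r with d = ⌊(q−1)/6⌋, shifting q by 12 shifts d by 2 and r by 6.
Δ₈-+12 : ∀ q → 1 ≤ q → Δ₈ (12 + q) ≡ Δ₈ q + (32 * q + 256)
Δ₈-+12 (suc p) _ = begin
  Δ₈ (12 + suc p)
    ≡⟨ cong (λ e → quadratic (12 + suc p) + 4 * (e + 1) * (12 + p ∸ 3 * e)) quotient ⟩
  quadratic (12 + suc p) + 4 * (2 + d + 1) * (12 + p ∸ 3 * (2 + d))
    ≡⟨ cong (λ e → quadratic (12 + suc p) + 4 * (2 + d + 1) * e) remainder ⟩
  quadratic (12 + suc p) + 4 * (2 + d + 1) * (6 + r)
    ≡⟨ polynomial p d r (sym (m+[n∸m]≡n 3d≤p)) ⟩
  Δ₈ (suc p) + (32 * suc p + 256)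
    ∎
  where
  open ≡-Reasoning
  d r : ℕ
  d = p / 6
  r = p ∸ 3 * d
  quotient : (12 + p) / 6 ≡ 2 + d
  quotient = +-distrib-/-∣ˡ {12} p {6} (divides 2 refl)
  3d≤p : 3 * d ≤ p
  3d≤p = ≤-trans (m≤m+n (3 * d) (3 * d)) (≤-trans (≤-reflexive (sym (twice d))) (m/n*n≤m p 6))
    where
    twice : ∀ d → d * 6 ≡ 3 * d + 3 * d
    twice = solve-∀
  remainder : 12 + p ∸ 3 * (2 + d) ≡ 6 + r
  remainder = trans (cong (12 + p ∸_) (distrib d)) (+-∸-assoc 6 3d≤p)
    where
    distrib : ∀ d → 3 * (2 + d) ≡ 6 + 3 * d
    distrib = solve-∀
  polynomial : ∀ p d r → p ≡ 3 * d + r →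
    quadratic (12 + suc p) + 4 * (2 + d + 1) * (6 + r) ≡ quadratic (suc p) + 4 * (d + 1) * r + (32 * suc p + 256)
  polynomial .(3 * d + r) d r refl = identity d r
    where
    identity : ∀ d r → let q = suc (3 * d + r) in
               (12 + q) * (12 + q) + 4 * (12 + q) + 3 + 4 * (2 + d + 1) * (6 + r)
               ≡ q * q + 4 * q + 3 + 4 * (d + 1) * r + (32 * q + 256)
    identity = solve-∀

Δ₈-by-thirds : ∀ (D : ℕ → ℕ) r → 1 ≤ r → (∀ K → D (3 + K) ≡ D K + (4 * (K * 4 + r) + 32)) →
               8 * D 0 ≡ Δ₈ r → 8 * D 1 ≡ Δ₈ (4 + r) → 8 * D 2 ≡ Δ₈ (8 + r) →
               ∀ K → 8 * D K ≡ Δ₈ (K * 4 + r)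
Δ₈-by-thirds D r 1≤r step D₀ D₁ D₂ zero                = D₀
Δ₈-by-thirds D r 1≤r step D₀ D₁ D₂ (suc zero)          = D₁
Δ₈-by-thirds D r 1≤r step D₀ D₁ D₂ (suc (suc zero))    = D₂
Δ₈-by-thirds D r 1≤r step D₀ D₁ D₂ (suc (suc (suc K))) = begin
  8 * D (3 + K)               ≡⟨ cong (8 *_) (step K) ⟩
  8 * (D K + (4 * q + 32))    ≡⟨ *-distribˡ-+ 8 (D K) _ ⟩
  8 * D K + 8 * (4 * q + 32)  ≡⟨ cong₂ _+_ (Δ₈-by-thirds D r 1≤r step D₀ D₁ D₂ K) (times8 q) ⟩
  Δ₈ q + (32 * q + 256)       ≡⟨ Δ₈-+12 q (≤-trans 1≤r (m≤n+m r (K * 4))) ⟨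
  Δ₈ (12 + q)                 ∎
  where
  open ≡-Reasoning
  q : ℕ
  q = K * 4 + r
  times8 : ∀ q → 8 * (4 * q + 32) ≡ 32 * q + 256
  times8 = solve-∀

-- Counting

module _ {A : Set} where

  HasCount-cong : ∀ {P Q : A → Set} {n} → (∀ a → P a ⇔ Q a) → HasCount P n → HasCount Q n
  HasCount-cong P⇔Q (xs , xs! , xs⇔P , length≡n) = xs , xs! , (λ a → ⇔.trans (xs⇔P a) (P⇔Q a)) , length≡n

  HasCount-∅ : ∀ {P : A → Set} → (∀ a → ¬ P a) → HasCount P 0
  HasCount-∅ ¬P = [] , [] , (λ a → mk⇔ (λ ()) (⊥-elim ∘ ¬P a)) , refl

  HasCount-≡ : ∀ (a : A) → HasCount (_≡ a) 1
  HasCount-≡ a = a ∷ [] , [] ∷ [] , (λ b → mk⇔ (λ { (here b≡a) → b≡a ; (there ()) }) here) , refl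

  HasCount-⊎ : ∀ {P Q : A → Set} {m n} → (∀ a → P a → Q a → ⊥) →
               HasCount P m → HasCount Q n → HasCount (λ a → P a ⊎ Q a) (m + n)
  HasCount-⊎ disjoint (xs , xs! , xs⇔P , refl) (ys , ys! , ys⇔Q , refl) =
    xs ++ ys ,
    Unique.++⁺ xs! ys! (λ (∈xs , ∈ys) → disjoint _ (to (xs⇔P _) ∈xs) (to (ys⇔Q _) ∈ys)) ,
    (λ a → mk⇔ (Sum.map (to (xs⇔P a)) (to (ys⇔Q a)) ∘ ∈-++⁻ xs)
               [ ∈-++⁺ˡ ∘ from (xs⇔P a) , ∈-++⁺ʳ xs ∘ from (ys⇔Q a) ]) ,
    length-++ xs

  HasCount-fibres : ∀ {P : A → Set} (g : A → ℕ) {c : ℕ → ℕ} n →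
                    (∀ j → j < n → HasCount (λ a → P a × g a ≡ j) (c j)) →
                    HasCount (λ a → P a × g a < n) (∑< n c)
  HasCount-fibres g zero    fibre = HasCount-∅ (λ a → λ ())
  HasCount-fibres {P} g (suc n) fibre =
    HasCount-cong split (HasCount-⊎ disjoint (HasCount-fibres g n (λ j → fibre j ∘ m<n⇒m<1+n)) (fibre n ≤-refl))
    where
    disjoint : ∀ a → P a × g a < n → P a × g a ≡ n → ⊥
    disjoint a (_ , g<n) (_ , refl) = <-irrefl refl g<n
    split : ∀ a → ((P a × g a < n) ⊎ (P a × g a ≡ n)) ⇔ (P a × g a < suc n)
    split a = mk⇔ [ (λ (p , g<n) → p , m<n⇒m<1+n g<n) , (λ where (p , refl) → p , ≤-refl) ]
                  (λ (p , g<1+n) → Sum.map (p ,_) (p ,_) (m<1+n⇒m<n∨m≡n g<1+n))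

HasCount-map : ∀ {A B : Set} {P : A → Set} {Q : B → Set} {n} (f : A → B) →
               (∀ {a a′} → P a → P a′ → f a ≡ f a′ → a ≡ a′) →
               (∀ b → Q b ⇔ ∃ λ a → P a × f a ≡ b) →
               HasCount P n → HasCount Q n
HasCount-map {P = P} f injective image (xs , xs! , xs⇔P , refl) =
  map f xs , map-unique (All.tabulate (to (xs⇔P _))) xs! ,
  (λ b → mk⇔ (λ b∈ → let (a , a∈ , b≡fa) = ∈-map⁻ f b∈ in
                      from (image b) (a , to (xs⇔P a) a∈ , sym b≡fa))
             (λ Qb → let (a , Pa , fa≡b) = to (image b) Qb in
                     subst (_∈ map f xs) fa≡b (∈-map⁺ f (from (xs⇔P a) Pa)))) ,
  length-map f xs
  where
  map-unique : ∀ {xs} → All P xs → Unique xs → Unique (map f xs)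
  map-unique []         []          = []
  map-unique (Pa ∷ Pas) (a∉ ∷ as!) =
    All.map⁺ (All.zipWith (λ (a≢b , Pb) fa≡fb → a≢b (injective Pa Pb fa≡fb)) (a∉ , Pas)) ∷ map-unique Pas as!

HasCount-interval : ∀ {l u} → l ≤ u → HasCount (λ z → l ≤ z × z < u) (u ∸ l)
HasCount-interval {l} {u} l≤u =
  subst (λ v → HasCount (λ z → l ≤ z × z < v) (u ∸ l)) (m+[n∸m]≡n l≤u) (from-length (u ∸ l))
  where
  from-length : ∀ d → HasCount (λ z → l ≤ z × z < l + d) d
  from-length zero    = HasCount-∅ λ z (l≤z , z<l+0) → <-irrefl (sym (+-identityʳ l)) (≤-<-trans l≤z z<l+0)
  from-length (suc d) = HasCount-cong split (HasCount-⊎ disjoint (HasCount-≡ (l + d)) (from-length d))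
    where
    l+d<l+1+d : l + d < l + suc d
    l+d<l+1+d = ≤-reflexive (sym (+-suc l d))
    disjoint : ∀ z → z ≡ l + d → l ≤ z × z < l + d → ⊥
    disjoint z refl (_ , z<l+d) = <-irrefl refl z<l+d
    split : ∀ z → (z ≡ l + d ⊎ (l ≤ z × z < l + d)) ⇔ (l ≤ z × z < l + suc d)
    split z = mk⇔ [ (λ where refl → m≤m+n l d , l+d<l+1+d) , (λ (l≤z , z<l+d) → l≤z , <-trans z<l+d l+d<l+1+d) ]
                  (λ (l≤z , z<l+1+d) → Sum.swap (Sum.map₁ (l≤z ,_)
                                         (m<1+n⇒m<n∨m≡n (subst (z <_) (+-suc l d) z<l+1+d))))

-- Kunz coordinates

data Residue : Set where
  r₀ r₁ r₂ r₃ : Residue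

⟦_⟧ : Residue → ℕ
⟦ r₀ ⟧ = 0
⟦ r₁ ⟧ = 1
⟦ r₂ ⟧ = 2
⟦ r₃ ⟧ = 3

⟦⟧<4 : ∀ ρ → ⟦ ρ ⟧ < 4
⟦⟧<4 r₀ = s≤s z≤n
⟦⟧<4 r₁ = s≤s (s≤s z≤n)
⟦⟧<4 r₂ = s≤s (s≤s (s≤s z≤n))
⟦⟧<4 r₃ = ≤-refl

residue : ℕ → Residue
residue 0                   = r₀
residue 1                   = r₁
residue 2                   = r₂
residue (suc (suc (suc _))) = r₃

⟦residue⟧ : ∀ {n} → n < 4 → ⟦ residue n ⟧ ≡ n
⟦residue⟧ {0} _ = refl
⟦residue⟧ {1} _ = refl
⟦residue⟧ {2} _ = refl
⟦residue⟧ {3} _ = refl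
⟦residue⟧ {suc (suc (suc (suc _)))} (s≤s (s≤s (s≤s (s≤s ()))))

_⊕_ : Residue → Residue → Residue
ρ ⊕ σ = residue ((⟦ ρ ⟧ + ⟦ σ ⟧) % 4)

carry : Residue → Residue → ℕ
carry ρ σ = (⟦ ρ ⟧ + ⟦ σ ⟧) / 4

⊕-carry : ∀ ρ σ → ⟦ ρ ⟧ + ⟦ σ ⟧ ≡ carry ρ σ * 4 + ⟦ ρ ⊕ σ ⟧
⊕-carry ρ σ = begin
  s                          ≡⟨ m≡m%n+[m/n]*n s 4 ⟩
  s % 4 + s / 4 * 4          ≡⟨ +-comm (s % 4) _ ⟩
  s / 4 * 4 + s % 4          ≡⟨ cong (s / 4 * 4 +_) (⟦residue⟧ (m%n<n s 4)) ⟨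
  carry ρ σ * 4 + ⟦ ρ ⊕ σ ⟧  ∎
  where
  open ≡-Reasoning
  s : ℕ
  s = ⟦ ρ ⟧ + ⟦ σ ⟧

data Mod4 : ℕ → Set where
  _·4+_ : ∀ a ρ → Mod4 (a * 4 + ⟦ ρ ⟧)

mod4 : ∀ n → Mod4 n
mod4 0 = 0 ·4+ r₀
mod4 1 = 0 ·4+ r₁
mod4 2 = 0 ·4+ r₂
mod4 3 = 0 ·4+ r₃
mod4 (suc (suc (suc (suc n)))) with mod4 n
... | a ·4+ ρ = suc a ·4+ ρ

·4+-<-suc : ∀ a ρ → a * 4 + ⟦ ρ ⟧ < suc a * 4
·4+-<-suc a ρ = subst (_< 4 + a * 4) (+-comm ⟦ ρ ⟧ (a * 4)) (+-monoˡ-< (a * 4) (⟦⟧<4 ρ))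

·4+-cancel-≤ : ∀ {m a} ρ → m * 4 ≤ a * 4 + ⟦ ρ ⟧ → m ≤ a
·4+-cancel-≤ {m} {a} ρ m*4≤ = s≤s⁻¹ (*-cancelʳ-< 4 m (suc a) (≤-<-trans m*4≤ (·4+-<-suc a ρ)))

·4+2<·4+ρ : ∀ {c b} ρ → ⟦ ρ ⟧ ≤ 2 → c * 4 + 2 < b * 4 + ⟦ ρ ⟧ → c < b
·4+2<·4+ρ {c} {b} ρ ρ≤2 lt =
  *-cancelʳ-< 4 c b (+-cancelʳ-< 2 (c * 4) (b * 4) (<-≤-trans lt (+-monoʳ-≤ (b * 4) ρ≤2)))

·4+-+ : ∀ a b ρ σ → a * 4 + ⟦ ρ ⟧ + (b * 4 + ⟦ σ ⟧) ≡ (carry ρ σ + (a + b)) * 4 + ⟦ ρ ⊕ σ ⟧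
·4+-+ a b ρ σ = begin
  a * 4 + ⟦ ρ ⟧ + (b * 4 + ⟦ σ ⟧)            ≡⟨ regroup a b ⟦ ρ ⟧ ⟦ σ ⟧ ⟩
  (a + b) * 4 + (⟦ ρ ⟧ + ⟦ σ ⟧)              ≡⟨ cong ((a + b) * 4 +_) (⊕-carry ρ σ) ⟩
  (a + b) * 4 + (carry ρ σ * 4 + ⟦ ρ ⊕ σ ⟧)  ≡⟨ carry-in (a + b) (carry ρ σ) ⟦ ρ ⊕ σ ⟧ ⟩
  (carry ρ σ + (a + b)) * 4 + ⟦ ρ ⊕ σ ⟧      ∎
  where
  open ≡-Reasoning
  regroup : ∀ a b i j → a * 4 + i + (b * 4 + j) ≡ (a + b) * 4 + (i + j)
  regroup = solve-∀
  carry-in : ∀ s c k → s * 4 + (c * 4 + k) ≡ (c + s) * 4 + k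
  carry-in = solve-∀

·4+-%2 : ∀ k i → (k * 4 + i) % 2 ≡ i % 2
·4+-%2 k i = trans (cong (_% 2) (regroup k i)) ([m+kn]%n≡m%n i (k * 2) 2)
  where
  regroup : ∀ k i → k * 4 + i ≡ i + k * 2 * 2
  regroup = solve-∀

record KunzCoords : Set where
  constructor ⟨_,_,_⟩
  field
    x₁ x₂ x₃ : ℕ
open KunzCoords

coord : Residue → KunzCoords → ℕ
coord r₀ _ = 0
coord r₁   = x₁
coord r₂   = x₂
coord r₃   = x₃

coord-injective : ∀ {t t′} → (∀ ρ → coord ρ t ≡ coord ρ t′) → t ≡ t′
coord-injective {⟨ _ , _ , _ ⟩} {⟨ _ , _ , _ ⟩} coord≡ with coord≡ r₁ | coord≡ r₂ | coord≡ r₃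
... | refl | refl | refl = refl

predᵏ : KunzCoords → KunzCoords
predᵏ t = ⟨ pred (x₁ t) , pred (x₂ t) , pred (x₃ t) ⟩

-- The semigroup whose Apéry set with respect to 4 is {4 · coord ρ t + ⟦ ρ ⟧}.
kunzSet : KunzCoords → Subsetℕ
kunzSet t 0 = true
kunzSet t 1 = x₁ t ≤ᵇ 0
kunzSet t 2 = x₂ t ≤ᵇ 0
kunzSet t 3 = x₃ t ≤ᵇ 0
kunzSet t (suc (suc (suc (suc n)))) = kunzSet (predᵏ t) n

kunzSet-≤ᵇ : ∀ t a ρ → kunzSet t (a * 4 + ⟦ ρ ⟧) ≡ (coord ρ t ≤ᵇ a)
kunzSet-≤ᵇ t zero    r₀ = refl
kunzSet-≤ᵇ t zero    r₁ = refl
kunzSet-≤ᵇ t zero    r₂ = refl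
kunzSet-≤ᵇ t zero    r₃ = refl
kunzSet-≤ᵇ t (suc a) ρ  = trans (kunzSet-≤ᵇ (predᵏ t) a ρ) (coord-pred ρ)
  where
  pred≤ᵇ : ∀ x → (pred x ≤ᵇ a) ≡ (x ≤ᵇ suc a)
  pred≤ᵇ zero          = refl
  pred≤ᵇ (suc zero)    = refl
  pred≤ᵇ (suc (suc x)) = refl
  coord-pred : ∀ ρ → (coord ρ (predᵏ t) ≤ᵇ a) ≡ (coord ρ t ≤ᵇ suc a)
  coord-pred r₀ = refl
  coord-pred r₁ = pred≤ᵇ (x₁ t)
  coord-pred r₂ = pred≤ᵇ (x₂ t)
  coord-pred r₃ = pred≤ᵇ (x₃ t)

∈-kunzSet : ∀ t a ρ → (a * 4 + ⟦ ρ ⟧) ∈ℕ kunzSet t ⇔ coord ρ t ≤ a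
∈-kunzSet t a ρ rewrite kunzSet-≤ᵇ t a ρ = ⇔.trans (⇔.sym T-≡) (mk⇔ (≤ᵇ⇒≤ _ _) ≤⇒≤ᵇ)

∈-above : ∀ t {M} → (∀ ρ → coord ρ t ≤ M) → ∀ n → M * 4 ≤ n → n ∈ℕ kunzSet t
∈-above t bound n M*4≤n with mod4 n
... | a ·4+ ρ = from (∈-kunzSet t a ρ) (≤-trans (bound ρ) (·4+-cancel-≤ ρ M*4≤n))

coord-antitone : ∀ {t t′} → (∀ n → n ∈ℕ kunzSet t → n ∈ℕ kunzSet t′) →
                 ∀ ρ → coord ρ t′ ≤ coord ρ t
coord-antitone {t} {t′} t⊆t′ ρ =
  to (∈-kunzSet t′ (coord ρ t) ρ) (t⊆t′ (coord ρ t * 4 + ⟦ ρ ⟧) (from (∈-kunzSet t (coord ρ t) ρ) ≤-refl))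

kunzSet-injective : ∀ {t t′} → (∀ n → kunzSet t n ≡ kunzSet t′ n) → t ≡ t′
kunzSet-injective t≗t′ = coord-injective λ ρ →
  ≤-antisym (coord-antitone (λ n → trans (t≗t′ n)) ρ) (coord-antitone (λ n → trans (sym (t≗t′ n))) ρ)

-- w_{ρ ⊕ σ} ≤ w_ρ + w_σ for the Apéry elements w_ρ = 4 · coord ρ t + ⟦ ρ ⟧.
KunzInequality : KunzCoords → Residue → Residue → Set
KunzInequality t ρ σ = coord (ρ ⊕ σ) t ≤ carry ρ σ + (coord ρ t + coord σ t)

-- The instances (ρ, σ) = (1,1), (3,3), (1,2), (2,3) of KunzInequality; they imply all the others.
Kunz : KunzCoords → Set
Kunz t = x₂ t ≤ x₁ t + x₁ t × x₂ t ≤ suc (x₃ t + x₃ t)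
        × x₃ t ≤ x₁ t + x₂ t × x₁ t ≤ suc (x₂ t + x₃ t)

kunz⇒inequality : ∀ {t} → Kunz t → ∀ ρ σ → KunzInequality t ρ σ
kunz⇒inequality {t} (y≤2x , y≤1+2z , z≤x+y , x≤1+y+z) = λ where
  r₀ r₀ → z≤n
  r₀ r₁ → ≤-refl
  r₀ r₂ → ≤-refl
  r₀ r₃ → ≤-refl
  r₁ r₀ → m≤m+n (x₁ t) 0
  r₁ r₁ → y≤2x
  r₁ r₂ → z≤x+y
  r₁ r₃ → z≤n
  r₂ r₀ → m≤m+n (x₂ t) 0
  r₂ r₁ → ≤-trans z≤x+y (≤-reflexive (+-comm (x₁ t) (x₂ t)))
  r₂ r₂ → z≤n
  r₂ r₃ → x≤1+y+z
  r₃ r₀ → m≤m+n (x₃ t) 0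
  r₃ r₁ → z≤n
  r₃ r₂ → ≤-trans x≤1+y+z (s≤s (≤-reflexive (+-comm (x₂ t) (x₃ t))))
  r₃ r₃ → y≤1+2z

inequalities⇒kunz : ∀ {t} → (∀ ρ σ → KunzInequality t ρ σ) → Kunz t
inequalities⇒kunz ineq = ineq r₁ r₁ , ineq r₃ r₃ , ineq r₁ r₂ , ineq r₂ r₃

kunzSet-+ : ∀ {t} → Kunz t → ∀ m n → m ∈ℕ kunzSet t → n ∈ℕ kunzSet t → (m + n) ∈ℕ kunzSet t
kunzSet-+ {t} kunz m n m∈ n∈ with mod4 m | mod4 n
... | a ·4+ ρ | b ·4+ σ =
  subst (_∈ℕ kunzSet t) (sym (·4+-+ a b ρ σ)) (from (∈-kunzSet t _ (ρ ⊕ σ))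
    (≤-trans (kunz⇒inequality kunz ρ σ)
             (+-monoʳ-≤ (carry ρ σ) (+-mono-≤ (to (∈-kunzSet t a ρ) m∈) (to (∈-kunzSet t b σ) n∈)))))

upward-least : ∀ (f : ℕ → Bool) → (∀ a → f a ≡ true → f (suc a) ≡ true) →
               ∀ b → f b ≡ true → ∃ λ x → ∀ a → f a ≡ true ⇔ x ≤ a
upward-least f up b fb with f 0 in f0≡
upward-least f up b       fb | true  = 0 , λ a → mk⇔ (λ _ → z≤n) (λ _ → f≡true a)
  where
  f≡true : ∀ a → f a ≡ true
  f≡true zero    = f0≡
  f≡true (suc a) = up a (f≡true a)
upward-least f up zero    fb | false with () ← trans (sym f0≡) fb
upward-least f up (suc b) fb | false =
  let (x , least) = upward-least (f ∘ suc) (up ∘ suc) b fb in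
  suc x , λ where
    zero    → mk⇔ (λ f0≡true → contradiction (trans (sym f0≡) f0≡true) λ ()) λ ()
    (suc a) → ⇔.trans (least a) (mk⇔ s≤s s≤s⁻¹)

module Apéry {H : Subsetℕ} (0∈H : 0 ∈ℕ H) (+-closed : ∀ a b → a ∈ℕ H → b ∈ℕ H → (a + b) ∈ℕ H)
             (F : ℕ) (above-F : ∀ n → F < n → n ∈ℕ H) (4∈H : 4 ∈ℕ H) where

  least : ∀ ρ → ∃ λ x → ∀ a → (a * 4 + ⟦ ρ ⟧) ∈ℕ H ⇔ x ≤ a
  least ρ = upward-least (λ a → H (a * 4 + ⟦ ρ ⟧)) (λ a → +-closed 4 _ 4∈H) (suc F)
              (above-F _ (≤-trans (m≤m*n (suc F) 4) (m≤m+n _ ⟦ ρ ⟧)))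

  coords : KunzCoords
  coords = ⟨ proj₁ (least r₁) , proj₁ (least r₂) , proj₁ (least r₃) ⟩

  ∈H : ∀ a ρ → (a * 4 + ⟦ ρ ⟧) ∈ℕ H ⇔ coord ρ coords ≤ a
  ∈H a r₀ = mk⇔ (λ _ → z≤n) (λ _ → multiple∈H a)
    where
    multiple∈H : ∀ a → (a * 4 + 0) ∈ℕ H
    multiple∈H zero    = 0∈H
    multiple∈H (suc a) = +-closed 4 _ 4∈H (multiple∈H a)
  ∈H a r₁ = proj₂ (least r₁) a
  ∈H a r₂ = proj₂ (least r₂) a
  ∈H a r₃ = proj₂ (least r₃) a

  H≗kunzSet : ∀ n → H n ≡ kunzSet coords n
  H≗kunzSet n with mod4 n
  ... | a ·4+ ρ = ⇔→≡ (⇔.trans (∈H a ρ) (⇔.sym (∈-kunzSet coords a ρ)))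

  coords-kunz : Kunz coords
  coords-kunz = inequalities⇒kunz λ ρ σ →
    to (∈H _ (ρ ⊕ σ)) (subst (_∈ℕ H) (·4+-+ (coord ρ coords) (coord σ coords) ρ σ)
                                      (+-closed _ _ (from (∈H _ ρ) ≤-refl) (from (∈H _ σ) ≤-refl)))

prefix : (N : ℕ) → Subsetℕ → Vec Bool N
prefix zero    H = []
prefix (suc N) H = H 0 ∷ prefix N (H ∘ suc)

setOf-prefix : ∀ N H → (∀ n → N ≤ n → H n ≡ true) → ∀ n → setOf (toList (prefix N H)) n ≡ H n
setOf-prefix zero    H above n       = sym (above n z≤n)
setOf-prefix (suc N) H above zero    = refl
setOf-prefix (suc N) H above (suc n) = setOf-prefix N (H ∘ suc) (λ n → above (suc n) ∘ s≤s) n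

prefix-setOf : ∀ {N} (v : Vec Bool N) → prefix N (setOf (toList v)) ≡ v
prefix-setOf []      = refl
prefix-setOf (b ∷ v) = cong (b ∷_) (prefix-setOf v)

prefix-cong : ∀ N {H G : Subsetℕ} → (∀ n → H n ≡ G n) → prefix N H ≡ prefix N G
prefix-cong zero    H≗G = refl
prefix-cong (suc N) H≗G = cong₂ _∷_ (H≗G 0) (prefix-cong N (H≗G ∘ suc))

Valid : ℕ → KunzCoords → Set
Valid q t = Kunz t × q ∈ℕ kunzSet t

WithinBound : ℕ → KunzCoords → Set
WithinBound q t = ∃ λ M → M * 4 ≤ Bound q × (∀ ρ → coord ρ t ≤ M)

data Odd : Residue → Set where
  odd₁ : Odd r₁
  odd₃ : Odd r₃

-- The bound M is the largest coordinate of ⟨4, q⟩, whose Frobenius number is 3q − 4.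
valid⇒withinBound : ∀ {ρ} → Odd ρ → ∀ k t → Valid (k * 4 + ⟦ ρ ⟧) t → WithinBound (k * 4 + ⟦ ρ ⟧) t
valid⇒withinBound odd₁ k t ((y≤2x , _ , z≤x+y , _) , q∈) =
  k + (k + k) , ≤-trans (m≤m+n _ 3) (≤-reflexive (identity k)) , bound
  where
  x≤k : x₁ t ≤ k
  x≤k = to (∈-kunzSet t k r₁) q∈
  y≤2k : x₂ t ≤ k + k
  y≤2k = ≤-trans y≤2x (+-mono-≤ x≤k x≤k)
  bound : ∀ ρ → coord ρ t ≤ k + (k + k)
  bound r₀ = z≤n
  bound r₁ = ≤-trans x≤k (m≤m+n k _)
  bound r₂ = ≤-trans y≤2k (m≤n+m _ k)
  bound r₃ = ≤-trans z≤x+y (+-mono-≤ x≤k y≤2k)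
  identity : ∀ k → (k + (k + k)) * 4 + 3 ≡ 3 * (k * 4 + 1)
  identity = solve-∀
valid⇒withinBound odd₃ k t ((_ , y≤1+2z , _ , x≤1+y+z) , q∈) =
  M , ≤-trans (m≤m+n _ 1) (≤-reflexive (identity k)) , bound
  where
  M : ℕ
  M = suc (suc (k + k) + k)
  z≤k : x₃ t ≤ k
  z≤k = to (∈-kunzSet t k r₃) q∈
  y≤1+2k : x₂ t ≤ suc (k + k)
  y≤1+2k = ≤-trans y≤1+2z (s≤s (+-mono-≤ z≤k z≤k))
  bound : ∀ ρ → coord ρ t ≤ M
  bound r₀ = z≤n
  bound r₁ = ≤-trans x≤1+y+z (s≤s (+-mono-≤ y≤1+2k z≤k))
  bound r₂ = ≤-trans y≤1+2k (s≤s (≤-trans (n≤1+n _) (m≤m+n _ k)))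
  bound r₃ = ≤-trans z≤k (≤-trans (m≤n+m k _) (n≤1+n _))
  identity : ∀ k → suc (suc (k + k) + k) * 4 + 1 ≡ 3 * (k * 4 + 3)
  identity = solve-∀

encode : (q : ℕ) → KunzCoords → Code q
encode q t = prefix (Bound q) (kunzSet t)

semigroupOf-encode : ∀ {q t} → WithinBound q t → ∀ n → semigroupOf q (encode q t) n ≡ kunzSet t n
semigroupOf-encode {q} {t} (M , M*4≤3q , bound) =
  setOf-prefix (Bound q) (kunzSet t) (λ n 3q≤n → ∈-above t bound n (≤-trans M*4≤3q 3q≤n))

encode-isNS4q : ∀ {q t} → Valid q t → WithinBound q t → IsNS4q q (encode q t)
encode-isNS4q {q} {t} (kunz , q∈) within@(M , M*4≤3q , bound) =
  (∈H 0 refl ,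
   (λ m n m∈ n∈ → ∈H _ (kunzSet-+ kunz m n (∈kunzSet m m∈) (∈kunzSet n n∈))) ,
   (Bound q , λ n 3q<n → ∈H n (∈-above t bound n (≤-trans M*4≤3q (<⇒≤ 3q<n))))) ,
  ∈H 4 refl ,
  ∈H q q∈
  where
  ∈H : ∀ n → n ∈ℕ kunzSet t → n ∈ℕ semigroupOf q (encode q t)
  ∈H n = trans (semigroupOf-encode {q} within n)
  ∈kunzSet : ∀ n → n ∈ℕ semigroupOf q (encode q t) → n ∈ℕ kunzSet t
  ∈kunzSet n = trans (sym (semigroupOf-encode {q} within n))

encode-injective : ∀ {q t t′} → WithinBound q t → WithinBound q t′ → encode q t ≡ encode q t′ → t ≡ t′
encode-injective {q} within within′ encode≡ = kunzSet-injective λ n →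
  trans (sym (semigroupOf-encode {q} within n))
        (trans (cong (λ v → semigroupOf q v n) encode≡) (semigroupOf-encode {q} within′ n))

encode-surjective : ∀ {q} v → IsNS4q q v → ∃ λ t → Valid q t × encode q t ≡ v
encode-surjective {q} v ((0∈ , +-closed , F , above-F) , 4∈ , q∈) =
  coords , (coords-kunz , trans (sym (H≗kunzSet q)) q∈) ,
  trans (prefix-cong (Bound q) (sym ∘ H≗kunzSet)) (prefix-setOf v)
  where open Apéry 0∈ +-closed F above-F 4∈

HasCount-encode : ∀ {q n} {P : KunzCoords → Set} {Q : Code q → Set} →
                  (∀ t → Valid q t → WithinBound q t) →
                  (∀ t → Valid q t → Q (encode q t) ⇔ P t) →
                  HasCount (λ t → Valid q t × P t) n → HasCount (λ v → IsNS4q q v × Q v) n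
HasCount-encode {q} {P = P} {Q} within Q⇔P = HasCount-map (encode q) injective image
  where
  injective : ∀ {t t′} → Valid q t × P t → Valid q t′ × P t′ → encode q t ≡ encode q t′ → t ≡ t′
  injective (valid , _) (valid′ , _) = encode-injective {q} (within _ valid) (within _ valid′)
  image : ∀ v → (IsNS4q q v × Q v) ⇔ ∃ λ t → (Valid q t × P t) × encode q t ≡ v
  image v = mk⇔
    (λ (ns , Qv) → let (t , valid , t↦v) = encode-surjective v ns in
                   t , (valid , to (Q⇔P t valid) (subst Q (sym t↦v) Qv)) , t↦v)
    (λ where (t , (valid , Pt) , refl) → encode-isNS4q {q} valid (within t valid) , from (Q⇔P t valid) Pt)

-- Genus and Frobenius number

countFalse-prefix : ∀ M N (H : Subsetℕ) → M ≤ N → (∀ n → M ≤ n → H n ≡ true) →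
                    countFalse (toList (prefix N H)) ≡ countFalse (toList (prefix M H))
countFalse-prefix zero    zero    H _         above = refl
countFalse-prefix zero    (suc N) H _         above rewrite above 0 z≤n =
  countFalse-prefix zero N (H ∘ suc) z≤n (λ n _ → above (suc n) z≤n)
countFalse-prefix (suc M) (suc N) H (s≤s M≤N) above with H 0
... | true  = countFalse-prefix M N (H ∘ suc) M≤N (λ n → above (suc n) ∘ s≤s)
... | false = cong suc (countFalse-prefix M N (H ∘ suc) M≤N (λ n → above (suc n) ∘ s≤s))

countFalse-≤ᵇ0 : ∀ x bs → countFalse ((x ≤ᵇ 0) ∷ bs) ≡ 1 ⊓ x + countFalse bs
countFalse-≤ᵇ0 zero    bs = refl
countFalse-≤ᵇ0 (suc x) bs = refl

1⊓n+pred[n]≡n : ∀ n → 1 ⊓ n + pred n ≡ n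
1⊓n+pred[n]≡n zero    = refl
1⊓n+pred[n]≡n (suc n) = refl

countFalse-kunzSet : ∀ M t → (∀ ρ → coord ρ t ≤ M) →
                     countFalse (toList (prefix (M * 4) (kunzSet t))) ≡ x₁ t + x₂ t + x₃ t
countFalse-kunzSet zero t bound
  rewrite n≤0⇒n≡0 (bound r₁) | n≤0⇒n≡0 (bound r₂) | n≤0⇒n≡0 (bound r₃) = refl
countFalse-kunzSet (suc M) t bound = begin
  countFalse ((x ≤ᵇ 0) ∷ (y ≤ᵇ 0) ∷ (z ≤ᵇ 0) ∷ rest)
    ≡⟨ countFalse-≤ᵇ0 x _ ⟩
  1 ⊓ x + countFalse ((y ≤ᵇ 0) ∷ (z ≤ᵇ 0) ∷ rest)
    ≡⟨ cong (1 ⊓ x +_) (trans (countFalse-≤ᵇ0 y _) (cong (1 ⊓ y +_) (countFalse-≤ᵇ0 z _))) ⟩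
  1 ⊓ x + (1 ⊓ y + (1 ⊓ z + countFalse rest))
    ≡⟨ cong (λ c → 1 ⊓ x + (1 ⊓ y + (1 ⊓ z + c))) (countFalse-kunzSet M (predᵏ t) pred-bound) ⟩
  1 ⊓ x + (1 ⊓ y + (1 ⊓ z + (pred x + pred y + pred z)))
    ≡⟨ regroup (1 ⊓ x) (1 ⊓ y) (1 ⊓ z) (pred x) (pred y) (pred z) ⟩
  (1 ⊓ x + pred x) + (1 ⊓ y + pred y) + (1 ⊓ z + pred z)
    ≡⟨ cong₂ _+_ (cong₂ _+_ (1⊓n+pred[n]≡n x) (1⊓n+pred[n]≡n y)) (1⊓n+pred[n]≡n z) ⟩
  x + y + z
    ∎
  where
  open ≡-Reasoning
  x y z : ℕ
  x = x₁ t
  y = x₂ t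
  z = x₃ t
  rest : List Bool
  rest = toList (prefix (M * 4) (kunzSet (predᵏ t)))
  pred-bound : ∀ ρ → coord ρ (predᵏ t) ≤ M
  pred-bound r₀ = z≤n
  pred-bound r₁ = pred-mono-≤ (bound r₁)
  pred-bound r₂ = pred-mono-≤ (bound r₂)
  pred-bound r₃ = pred-mono-≤ (bound r₃)
  regroup : ∀ a b c d e f → a + (b + (c + (d + e + f))) ≡ (a + d) + (b + e) + (c + f)
  regroup = solve-∀

genus-encode : ∀ {q t} → WithinBound q t → genus q (encode q t) ≡ x₁ t + x₂ t + x₃ t
genus-encode {q} {t} (M , M*4≤3q , bound) =
  trans (countFalse-prefix (M * 4) (Bound q) (kunzSet t) M*4≤3q (∈-above t bound)) (countFalse-kunzSet M t bound)

IsLargestGap : Subsetℕ → ℕ → Set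
IsLargestGap H m = H m ≡ false × (∀ n → m < n → H n ≡ true)

IsLargestGap-cong : ∀ {H G m} → (∀ n → H n ≡ G n) → IsLargestGap H m → IsLargestGap G m
IsLargestGap-cong {m = m} H≗G (gap , above) = trans (sym (H≗G m)) gap , λ n m<n → trans (sym (H≗G n)) (above n m<n)

largestGap-unique : ∀ {H m m′} → IsLargestGap H m → IsLargestGap H m′ → m ≡ m′
largestGap-unique (gap , above) (gap′ , above′) with <-cmp _ _
... | tri< m<m′ _ _ = contradiction (trans (sym (above _ m<m′)) gap′) λ ()
... | tri≈ _ m≡m′ _ = m≡m′
... | tri> _ _ m′<m = contradiction (trans (sym (above′ _ m′<m)) gap) λ ()

lastGap-nothing : ∀ bs → lastGap bs ≡ nothing → ∀ n → setOf bs n ≡ true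
lastGap-nothing []       _  n = refl
lastGap-nothing (b ∷ bs) eq n with lastGap bs in e
lastGap-nothing (true ∷ bs) refl zero    | nothing = refl
lastGap-nothing (true ∷ bs) refl (suc n) | nothing = lastGap-nothing bs e n

lastGap-just : ∀ bs {m} → lastGap bs ≡ just m → IsLargestGap (setOf bs) m
lastGap-just (b ∷ bs) eq with lastGap bs in e
lastGap-just (b ∷ bs)     refl | just k  =
  let (gap , above) = lastGap-just bs e in gap , λ where (suc n) (s≤s k<n) → above n k<n
lastGap-just (false ∷ bs) refl | nothing = refl , λ where (suc n) _ → lastGap-nothing bs e n

lastGap-complete : ∀ bs {m} → IsLargestGap (setOf bs) m → lastGap bs ≡ just m
lastGap-complete bs largest@(gap , _) with lastGap bs in e
... | just m′ = cong just (largestGap-unique (lastGap-just bs e) largest)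
... | nothing = contradiction (trans (sym (lastGap-nothing bs e _)) gap) λ ()

frobenius-equation : ∀ g (r : Maybe ℕ) →
  (ℤ.+ 2 ℤ.* ℤ.+ g ≡ maybe ℤ.+_ ℤ.-[1+ 0 ] r ℤ.+ ℤ.+ 2) ⇔ (∃ λ m → r ≡ just m × 2 * g ≡ m + 2)
frobenius-equation g nothing  =
  mk⇔ (λ eq → contradiction (ℤₚ.+-injective (trans (ℤₚ.pos-* 2 g) eq)) (even≢odd g 0)) λ ()
frobenius-equation g (just m) =
  mk⇔ (λ eq → m , refl , ℤₚ.+-injective (trans (ℤₚ.pos-* 2 g) eq))
      (λ where (_ , refl , eq) → trans (sym (ℤₚ.pos-* 2 g)) (cong ℤ.+_ eq))

isPseudoSymmetric⇔ : ∀ q v → IsPseudoSymmetric q v ⇔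
                     ∃ λ m → IsLargestGap (semigroupOf q v) m × 2 * genus q v ≡ m + 2
isPseudoSymmetric⇔ q v = ⇔.trans (frobenius-equation (genus q v) (lastGap (toList v)))
  (mk⇔ (λ (m , e , eq) → m , lastGap-just (toList v) e , eq)
       (λ (m , gap , eq) → m , lastGap-complete (toList v) gap , eq))

largestGap-x₂ : ∀ t c → x₂ t ≡ suc c → x₁ t ≤ suc c → x₃ t ≤ c → IsLargestGap (kunzSet t) (c * 4 + 2)
largestGap-x₂ t c y≡1+c x≤1+c z≤c = gap , above
  where
  gap : kunzSet t (c * 4 + 2) ≡ false
  gap = ¬-not λ ∈ → 1+n≰n (subst (_≤ c) y≡1+c (to (∈-kunzSet t c r₂) ∈))
  above : ∀ n → c * 4 + 2 < n → n ∈ℕ kunzSet t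
  above n m<n with mod4 n
  ... | b ·4+ ρ = from (∈-kunzSet t b ρ) (coord≤ ρ m<n)
    where
    coord≤ : ∀ ρ → c * 4 + 2 < b * 4 + ⟦ ρ ⟧ → coord ρ t ≤ b
    coord≤ r₀ _  = z≤n
    coord≤ r₁ lt = ≤-trans x≤1+c (·4+2<·4+ρ r₁ (s≤s z≤n) lt)
    coord≤ r₂ lt = ≤-trans (≤-reflexive y≡1+c) (·4+2<·4+ρ r₂ ≤-refl lt)
    coord≤ r₃ lt = ≤-trans z≤c (·4+-cancel-≤ r₃ (≤-trans (m≤m+n (c * 4) 2) (<⇒≤ lt)))

-- Pseudo-symmetry of kunzSet t, with its genus x₁ + x₂ + x₃ already substituted.
PseudoSymmetricKunzSet : KunzCoords → Set
PseudoSymmetricKunzSet t = ∃ λ m → IsLargestGap (kunzSet t) m × 2 * (x₁ t + x₂ t + x₃ t) ≡ m + 2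

PseudoSymmetricCoords : KunzCoords → Set
PseudoSymmetricCoords t = 0 < x₁ t × x₂ t ≡ x₁ t + x₃ t

-- By parity F ≡ 2 (mod 4); then F = 4 x₂ − 2.
pseudoSymmetricKunzSet⇒coords : ∀ t → PseudoSymmetricKunzSet t → PseudoSymmetricCoords t
pseudoSymmetricKunzSet⇒coords t@(⟨ x , y , z ⟩) (m , (gap , above) , 2g≡F+2) with mod4 m
... | a ·4+ r₀ = contradiction (trans (sym (from (∈-kunzSet t a r₀) z≤n)) gap) λ ()
... | a ·4+ r₁ = contradiction (trans 2g≡F+2 (odd-identity a)) (even≢odd (x + y + z) (a * 2 + 1))
  where
  odd-identity : ∀ a → a * 4 + 1 + 2 ≡ suc (2 * (a * 2 + 1))
  odd-identity = solve-∀
... | a ·4+ r₃ = contradiction (trans 2g≡F+2 (odd-identity a)) (even≢odd (x + y + z) (a * 2 + 2))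
  where
  odd-identity : ∀ a → a * 4 + 3 + 2 ≡ suc (2 * (a * 2 + 2))
  odd-identity = solve-∀
... | a ·4+ r₂ = n≢0⇒n>0 x≢0 , trans y≡1+a (sym x+z≡1+a)
  where
  y≡1+a : y ≡ suc a
  y≡1+a = ≤-antisym (to (∈-kunzSet t (suc a) r₂) (above _ (m≤n+m (suc (a * 4 + 2)) 3)))
                    (≰⇒> λ y≤a → contradiction (trans (sym (from (∈-kunzSet t a r₂) y≤a)) gap) λ ())
  z≤a : z ≤ a
  z≤a = to (∈-kunzSet t a r₃) (above _ (+-monoʳ-< (a * 4) (n<1+n 2)))
  x+z≡1+a : x + z ≡ suc a
  x+z≡1+a = +-cancelʳ-≡ (suc a) (x + z) (suc a) (begin
    x + z + suc a  ≡⟨ cong (x + z +_) y≡1+a ⟨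
    x + z + y      ≡⟨ swap x y z ⟩
    x + y + z      ≡⟨ *-cancelˡ-≡ _ _ 2 (trans 2g≡F+2 (even-identity a)) ⟩
    suc a + suc a  ∎)
    where
    open ≡-Reasoning
    swap : ∀ x y z → x + z + y ≡ x + y + z
    swap = solve-∀
    even-identity : ∀ a → a * 4 + 2 + 2 ≡ 2 * (suc a + suc a)
    even-identity = solve-∀
  x≢0 : x ≢ 0
  x≢0 x≡0 = 1+n≰n (subst (_≤ a) (trans (cong (_+ z) (sym x≡0)) x+z≡1+a) z≤a)

coords⇒pseudoSymmetricKunzSet : ∀ t → PseudoSymmetricCoords t → PseudoSymmetricKunzSet t
coords⇒pseudoSymmetricKunzSet t@(⟨ suc s , _ , z ⟩) (s≤s z≤n , refl) =
  (s + z) * 4 + 2 , largestGap-x₂ t (s + z) refl (s≤s (m≤m+n s z)) (m≤n+m z s) , identity s z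
  where
  identity : ∀ s z → 2 * (suc s + (suc s + z) + z) ≡ (s + z) * 4 + 2 + 2
  identity = solve-∀

pseudoSymmetric-encode : ∀ {q t} → WithinBound q t → IsPseudoSymmetric q (encode q t) ⇔ PseudoSymmetricCoords t
pseudoSymmetric-encode {q} {t} within = ⇔.trans (isPseudoSymmetric⇔ q (encode q t)) (mk⇔
  (λ (m , gap , eq) → pseudoSymmetricKunzSet⇒coords t
                        (m , IsLargestGap-cong (semigroupOf-encode {q} within) gap , trans (cong (2 *_) (sym genus≡)) eq))
  (λ psc → let (m , gap , eq) = coords⇒pseudoSymmetricKunzSet t psc in
           m , IsLargestGap-cong (sym ∘ semigroupOf-encode {q} within) gap , trans (cong (2 *_) genus≡) eq))
  where
  genus≡ : genus q (encode q t) ≡ x₁ t + x₂ t + x₃ t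
  genus≡ = genus-encode {q} within

-- Slices of the Kunz polytope

Valid⇔ : ∀ {ρ} k t → Valid (k * 4 + ⟦ ρ ⟧) t ⇔ (Kunz t × coord ρ t < suc k)
Valid⇔ {ρ} k t = mk⇔ (λ (kunz , q∈) → kunz , s≤s (to (∈-kunzSet t k ρ) q∈))
                     (λ (kunz , c<1+k) → kunz , from (∈-kunzSet t k ρ) (s≤s⁻¹ c<1+k))

offset₁ : ℕ → ℕ
offset₁ j = suc j + ⌊ j /2⌋

offset₁-≥ : ∀ j → j ≤ offset₁ j
offset₁-≥ j = ≤-trans (n≤1+n j) (m≤m+n (suc j) _)

rowLength₁ : ℕ → ℕ → ℕ
rowLength₁ K j = suc (K + j) ∸ (⌊ j /2⌋ ⊔ (K ∸ suc j))

fibreSize₁ : ℕ → ℕ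
fibreSize₁ K = ∑[ j < suc (K + K) ] rowLength₁ K j

row-bounds₁ : ∀ K j → ⌊ j /2⌋ ≤ suc (K + j) × K ∸ suc j ≤ suc (K + j)
row-bounds₁ K j = ≤-trans (⌊n/2⌋≤n j) (≤-trans (m≤n+m j K) (n≤1+n _)) ,
                  ≤-trans (m∸n≤m K (suc j)) (≤-trans (m≤m+n K j) (n≤1+n _))

kunz-row₁ : ∀ K j z → Kunz ⟨ K , j , z ⟩ ⇔
                      (j < suc (K + K) × (⌊ j /2⌋ ⊔ (K ∸ suc j) ≤ z × z < suc (K + j)))
kunz-row₁ K j z = mk⇔
  (λ (j≤2K , j≤1+2z , z≤K+j , K≤1+j+z) →
     s≤s j≤2K ,
     ⊔-lub (from (⌊n/2⌋≤m⇔n≤1+m+m j z) j≤1+2z) (m≤n+o⇒m∸n≤o K (suc j) K≤1+j+z) ,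
     s≤s z≤K+j)
  (λ (j<1+2K , lo≤z , z<1+K+j) →
     s≤s⁻¹ j<1+2K , to (⌊n/2⌋≤m⇔n≤1+m+m j z) (m⊔n≤o⇒m≤o _ _ lo≤z) , s≤s⁻¹ z<1+K+j ,
     ≤-trans (m≤n+m∸n K (suc j)) (+-monoʳ-≤ (suc j) (m⊔n≤o⇒n≤o _ _ lo≤z)))

fibre-count₁ : ∀ K → HasCount (λ t → Kunz t × x₁ t ≡ K) (fibreSize₁ K)
fibre-count₁ K = HasCount-cong (λ t → mk⇔ proj₁ λ where p@(kunz , refl) → p , s≤s (proj₁ kunz))
                   (HasCount-fibres x₂ (suc (K + K)) row-count)
  where
  row-count : ∀ j → j < suc (K + K) → HasCount (λ t → (Kunz t × x₁ t ≡ K) × x₂ t ≡ j) (rowLength₁ K j)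
  row-count j j<1+2K = HasCount-map (λ z → ⟨ K , j , z ⟩) (λ _ _ → cong x₃) image (HasCount-interval lo≤u)
    where
    lo≤u : ⌊ j /2⌋ ⊔ (K ∸ suc j) ≤ suc (K + j)
    lo≤u = ⊔-lub (proj₁ (row-bounds₁ K j)) (proj₂ (row-bounds₁ K j))
    image : ∀ t → ((Kunz t × x₁ t ≡ K) × x₂ t ≡ j) ⇔
                  ∃ λ z → (⌊ j /2⌋ ⊔ (K ∸ suc j) ≤ z × z < suc (K + j)) × ⟨ K , j , z ⟩ ≡ t
    image ⟨ _ , _ , z ⟩ = mk⇔ (λ where ((kunz , refl) , refl) → z , proj₂ (to (kunz-row₁ K j z) kunz) , refl)
                              (λ where (z , z∈ , refl) → (from (kunz-row₁ K j z) (j<1+2K , z∈) , refl) , refl)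

fibreSize₁+triangle : ∀ K → fibreSize₁ K + triangle offset₁ K ≡ K * K * 3 + K * 4 + 1
fibreSize₁+triangle K = begin
  fibreSize₁ K + triangle offset₁ K                   ≡⟨ cong (fibreSize₁ K +_) triangle≡ ⟨
  fibreSize₁ K + ∑[ j < n ] ((K ∸ suc j) ∸ ⌊ j /2⌋)
    ≡⟨ ∑<-∸-⊔ n (λ j → suc (K + j)) ⌊_/2⌋ (λ j → K ∸ suc j) (proj₁ ∘ row-bounds₁ K) (proj₂ ∘ row-bounds₁ K) ⟩
  ∑[ j < n ] (suc (K + j) ∸ ⌊ j /2⌋)                 ≡⟨ ∑<-cong n (+-∸-⌊n/2⌋ (suc K)) ⟩
  ∑[ j < n ] (suc K + ⌈ j /2⌉)                       ≡⟨ ∑<-const+ n (suc K) ⌈_/2⌉ ⟩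
  n * suc K + ∑[ j < n ] ⌈ j /2⌉                     ≡⟨ cong (n * suc K +_) (∑<-⌈n/2⌉ K) ⟩
  n * suc K + (K * K + K)                            ≡⟨ identity K ⟩
  K * K * 3 + K * 4 + 1                              ∎
  where
  open ≡-Reasoning
  n : ℕ
  n = suc (K + K)
  triangle≡ : ∑[ j < n ] ((K ∸ suc j) ∸ ⌊ j /2⌋) ≡ triangle offset₁ K
  triangle≡ = trans (∑<-cong n (λ j → ∸-+-assoc K (suc j) ⌊ j /2⌋))
                    (triangle-∑< offset₁ offset₁-≥ (≤-trans (m≤m+n K K) (n≤1+n _)))
  identity : ∀ K → suc (K + K) * suc K + (K * K + K) ≡ K * K * 3 + K * 4 + 1
  identity = solve-∀

fibreSize₁-step : ∀ K → fibreSize₁ (3 + K) ≡ fibreSize₁ K + (4 * (K * 4 + 1) + 32)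
fibreSize₁-step K = cancel-complement (fibreSize₁ K) (triangle offset₁ K) (2 + K + (1 + K)) _ (fibreSize₁+triangle K)
  (trans (cong (fibreSize₁ (3 + K) +_) (sym (triangle-step offset₁ offset₁-≥ offset₁-step K)))
         (fibreSize₁+triangle (3 + K)))
  (identity K)
  where
  offset₁-step : ∀ j → offset₁ (2 + j) ≡ 3 + offset₁ j
  offset₁-step j = cong (suc ∘ suc ∘ suc) (+-suc j ⌊ j /2⌋)
  identity : ∀ K → (3 + K) * (3 + K) * 3 + (3 + K) * 4 + 1
                   ≡ K * K * 3 + K * 4 + 1 + ((2 + K + (1 + K)) + (4 * (K * 4 + 1) + 32))
  identity = solve-∀

offset₃ : ℕ → ℕ
offset₃ j = j + ⌈ j /2⌉

rowLength₃ : ℕ → ℕ → ℕ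
rowLength₃ K j = suc (suc (j + K)) ∸ (⌈ j /2⌉ ⊔ (K ∸ j))

fibreSize₃ : ℕ → ℕ
fibreSize₃ K = ∑[ j < suc (suc (K + K)) ] rowLength₃ K j

row-bounds₃ : ∀ K j → ⌈ j /2⌉ ≤ suc (suc (j + K)) × K ∸ j ≤ suc (suc (j + K))
row-bounds₃ K j = ≤-trans (⌈n/2⌉≤n j) (≤-trans (m≤m+n j K) (≤-trans (n≤1+n _) (n≤1+n _))) ,
                  ≤-trans (m∸n≤m K j) (≤-trans (m≤n+m K j) (≤-trans (n≤1+n _) (n≤1+n _)))

kunz-row₃ : ∀ K j i → Kunz ⟨ i , j , K ⟩ ⇔
                      (j < suc (suc (K + K)) × (⌈ j /2⌉ ⊔ (K ∸ j) ≤ i × i < suc (suc (j + K))))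
kunz-row₃ K j i = mk⇔
  (λ (j≤2i , j≤1+2K , K≤i+j , i≤1+j+K) →
     s≤s j≤1+2K ,
     ⊔-lub (from (⌈n/2⌉≤m⇔n≤m+m j i) j≤2i) (m≤n+o⇒m∸n≤o K j (subst (K ≤_) (+-comm i j) K≤i+j)) ,
     s≤s i≤1+j+K)
  (λ (j<2+2K , lo≤i , i<2+j+K) →
     to (⌈n/2⌉≤m⇔n≤m+m j i) (m⊔n≤o⇒m≤o _ _ lo≤i) , s≤s⁻¹ j<2+2K ,
     subst (K ≤_) (+-comm j i) (≤-trans (m≤n+m∸n K j) (+-monoʳ-≤ j (m⊔n≤o⇒n≤o _ _ lo≤i))) ,
     s≤s⁻¹ i<2+j+K)

fibre-count₃ : ∀ K → HasCount (λ t → Kunz t × x₃ t ≡ K) (fibreSize₃ K)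
fibre-count₃ K = HasCount-cong (λ t → mk⇔ proj₁ λ where p@(kunz , refl) → p , s≤s (proj₁ (proj₂ kunz)))
                   (HasCount-fibres x₂ (suc (suc (K + K))) row-count)
  where
  row-count : ∀ j → j < suc (suc (K + K)) →
              HasCount (λ t → (Kunz t × x₃ t ≡ K) × x₂ t ≡ j) (rowLength₃ K j)
  row-count j j<2+2K = HasCount-map (λ i → ⟨ i , j , K ⟩) (λ _ _ → cong x₁) image (HasCount-interval lo≤u)
    where
    lo≤u : ⌈ j /2⌉ ⊔ (K ∸ j) ≤ suc (suc (j + K))
    lo≤u = ⊔-lub (proj₁ (row-bounds₃ K j)) (proj₂ (row-bounds₃ K j))
    image : ∀ t → ((Kunz t × x₃ t ≡ K) × x₂ t ≡ j) ⇔
                  ∃ λ i → (⌈ j /2⌉ ⊔ (K ∸ j) ≤ i × i < suc (suc (j + K))) × ⟨ i , j , K ⟩ ≡ t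
    image ⟨ i , _ , _ ⟩ = mk⇔ (λ where ((kunz , refl) , refl) → i , proj₂ (to (kunz-row₃ K j i) kunz) , refl)
                              (λ where (i , i∈ , refl) → (from (kunz-row₃ K j i) (j<2+2K , i∈) , refl) , refl)

fibreSize₃+triangle : ∀ K → fibreSize₃ K + triangle offset₃ K ≡ K * K * 3 + K * 7 + 4
fibreSize₃+triangle K = begin
  fibreSize₃ K + triangle offset₃ K               ≡⟨ cong (fibreSize₃ K +_) triangle≡ ⟨
  fibreSize₃ K + ∑[ j < n ] ((K ∸ j) ∸ ⌈ j /2⌉)
    ≡⟨ ∑<-∸-⊔ n (λ j → suc (suc (j + K))) ⌈_/2⌉ (K ∸_) (proj₁ ∘ row-bounds₃ K) (proj₂ ∘ row-bounds₃ K) ⟩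
  ∑[ j < n ] (suc (suc (j + K)) ∸ ⌈ j /2⌉)       ≡⟨ ∑<-cong n row ⟩
  ∑[ j < n ] (suc (suc K) + ⌊ j /2⌋)             ≡⟨ ∑<-const+ n (suc (suc K)) ⌊_/2⌋ ⟩
  n * suc (suc K) + ∑[ j < n ] ⌊ j /2⌋           ≡⟨ cong (n * suc (suc K) +_) (∑<-⌊n/2⌋ K) ⟩
  n * suc (suc K) + (K * K + K)                  ≡⟨ identity K ⟩
  K * K * 3 + K * 7 + 4                          ∎
  where
  open ≡-Reasoning
  n : ℕ
  n = suc (suc (K + K))
  triangle≡ : ∑[ j < n ] ((K ∸ j) ∸ ⌈ j /2⌉) ≡ triangle offset₃ K
  triangle≡ = trans (∑<-cong n (λ j → ∸-+-assoc K j ⌈ j /2⌉))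
                    (triangle-∑< offset₃ (λ j → m≤m+n j _) (≤-trans (m≤m+n K K) (m≤n+m _ 2)))
  row : ∀ j → suc (suc (j + K)) ∸ ⌈ j /2⌉ ≡ suc (suc K) + ⌊ j /2⌋
  row j = trans (cong (λ m → suc (suc m) ∸ ⌈ j /2⌉) (+-comm j K)) (+-∸-⌈n/2⌉ (suc (suc K)) j)
  identity : ∀ K → suc (suc (K + K)) * suc (suc K) + (K * K + K) ≡ K * K * 3 + K * 7 + 4
  identity = solve-∀

fibreSize₃-step : ∀ K → fibreSize₃ (3 + K) ≡ fibreSize₃ K + (4 * (K * 4 + 3) + 32)
fibreSize₃-step K = cancel-complement (fibreSize₃ K) (triangle offset₃ K) (3 + K + (1 + K)) _ (fibreSize₃+triangle K)
  (trans (cong (fibreSize₃ (3 + K) +_) (sym (triangle-step offset₃ (λ j → m≤m+n j _) offset₃-step K)))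
         (fibreSize₃+triangle (3 + K)))
  (identity K)
  where
  offset₃-step : ∀ j → offset₃ (2 + j) ≡ 3 + offset₃ j
  offset₃-step j = cong (suc ∘ suc) (+-suc j ⌈ j /2⌉)
  identity : ∀ K → (3 + K) * (3 + K) * 3 + (3 + K) * 7 + 4
                   ≡ K * K * 3 + K * 7 + 4 + ((3 + K + (1 + K)) + (4 * (K * 4 + 3) + 32))
  identity = solve-∀

fibreSize : ∀ {ρ} → Odd ρ → ℕ → ℕ
fibreSize odd₁ = fibreSize₁
fibreSize odd₃ = fibreSize₃

fibre-count : ∀ {ρ} (o : Odd ρ) K → HasCount (λ t → Kunz t × coord ρ t ≡ K) (fibreSize o K)
fibre-count odd₁ = fibre-count₁
fibre-count odd₃ = fibre-count₃

fibreSize-Δ₈ : ∀ {ρ} (o : Odd ρ) K → 8 * fibreSize o K ≡ Δ₈ (K * 4 + ⟦ ρ ⟧)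
fibreSize-Δ₈ odd₁ = Δ₈-by-thirds fibreSize₁ 1 ≤-refl fibreSize₁-step refl refl refl
fibreSize-Δ₈ odd₃ = Δ₈-by-thirds fibreSize₃ 3 (s≤s z≤n) fibreSize₃-step refl refl refl

IsN4-∑ : ∀ {ρ} (o : Odd ρ) k → IsN4 (k * 4 + ⟦ ρ ⟧) (∑< (suc k) (fibreSize o))
IsN4-∑ {ρ} o k =
  HasCount-cong (λ _ → mk⇔ proj₁ (_, tt))
    (HasCount-encode (valid⇒withinBound o k) (λ _ _ → ⇔.refl)
      (HasCount-cong (λ t → mk⇔ ((_, tt) ∘ from (Valid⇔ k t)) (to (Valid⇔ k t) ∘ proj₁))
        (HasCount-fibres (coord ρ) (suc k) (λ K _ → fibre-count o K))))

pseudoSymmetric₀ pseudoSymmetric₁ : ℕ → KunzCoords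
pseudoSymmetric₀ s = ⟨ suc s , suc (s + s) , s ⟩
pseudoSymmetric₁ s = ⟨ suc s , suc (s + suc s) , suc s ⟩

Shape : KunzCoords → Set
Shape t = ∃ λ s → t ≡ pseudoSymmetric₀ s ⊎ t ≡ pseudoSymmetric₁ s

pseudoSymmetric-shape : ∀ t → (Kunz t × PseudoSymmetricCoords t) ⇔ Shape t
pseudoSymmetric-shape t = mk⇔ shape λ where
    (s , inj₁ refl) → kunz₀ s , s≤s z≤n , refl
    (s , inj₂ refl) → kunz₁ s , s≤s z≤n , refl
  where
  shape : ∀ {t} → Kunz t × PseudoSymmetricCoords t → Shape t
  shape {⟨ suc s , _ , z ⟩} ((y≤2x , y≤1+2z , _ , _) , s≤s z≤n , refl) with m≤n⇒m<n∨m≡n s≤z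
    where
    s≤z : s ≤ z
    s≤z = +-cancelʳ-≤ z s z (s≤s⁻¹ y≤1+2z)
  ... | inj₂ refl = s , inj₁ refl
  ... | inj₁ s<z rewrite ≤-antisym (+-cancelˡ-≤ s z (suc s) (s≤s⁻¹ y≤2x)) s<z = s , inj₂ refl
  kunz₀ : ∀ s → Kunz (pseudoSymmetric₀ s)
  kunz₀ s = s≤s (+-monoʳ-≤ s (n≤1+n s)) , ≤-refl , ≤-trans (n≤1+n s) (m≤m+n _ _) ,
            s≤s (≤-trans (m≤m+n s s) (≤-trans (n≤1+n _) (m≤m+n _ s)))
  kunz₁ : ∀ s → Kunz (pseudoSymmetric₁ s)
  kunz₁ s = ≤-refl , n≤1+n _ , m≤m+n _ _ , s≤s (≤-trans (n≤1+n s) (≤-trans (m≤m+n _ _) (m≤m+n _ _)))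

psymFibreSize : ∀ {ρ} → Odd ρ → ℕ → ℕ
psymFibreSize _    (suc _) = 2
psymFibreSize odd₁ zero    = 0
psymFibreSize odd₃ zero    = 1

psym-fibre-count : ∀ {ρ} (o : Odd ρ) K →
                   HasCount (λ t → (Kunz t × PseudoSymmetricCoords t) × coord ρ t ≡ K) (psymFibreSize o K)
psym-fibre-count odd₁ zero    = HasCount-∅ λ where t ((_ , 0<x , _) , x≡0) → <-irrefl (sym x≡0) 0<x
psym-fibre-count odd₁ (suc s) =
  HasCount-cong fibre (HasCount-⊎ distinct (HasCount-≡ (pseudoSymmetric₀ s)) (HasCount-≡ (pseudoSymmetric₁ s)))
  where
  distinct : ∀ t → t ≡ pseudoSymmetric₀ s → t ≡ pseudoSymmetric₁ s → ⊥
  distinct t refl e = <-irrefl (cong x₃ e) (n<1+n s)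
  select : ∀ {t} → Shape t → x₁ t ≡ suc s → t ≡ pseudoSymmetric₀ s ⊎ t ≡ pseudoSymmetric₁ s
  select (_ , inj₁ refl) refl = inj₁ refl
  select (_ , inj₂ refl) refl = inj₂ refl
  fibre : ∀ t → (t ≡ pseudoSymmetric₀ s ⊎ t ≡ pseudoSymmetric₁ s) ⇔
                ((Kunz t × PseudoSymmetricCoords t) × x₁ t ≡ suc s)
  fibre t = mk⇔ (λ where (inj₁ refl) → from (pseudoSymmetric-shape t) (s , inj₁ refl) , refl
                         (inj₂ refl) → from (pseudoSymmetric-shape t) (s , inj₂ refl) , refl)
                (λ (kp , x≡) → select (to (pseudoSymmetric-shape t) kp) x≡)
psym-fibre-count odd₃ zero    = HasCount-cong fibre (HasCount-≡ (pseudoSymmetric₀ 0))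
  where
  select : ∀ {t} → Shape t → x₃ t ≡ 0 → t ≡ pseudoSymmetric₀ 0
  select (_ , inj₁ refl) refl = refl
  fibre : ∀ t → t ≡ pseudoSymmetric₀ 0 ⇔ ((Kunz t × PseudoSymmetricCoords t) × x₃ t ≡ 0)
  fibre t = mk⇔ (λ where refl → from (pseudoSymmetric-shape t) (0 , inj₁ refl) , refl)
                (λ (kp , z≡) → select (to (pseudoSymmetric-shape t) kp) z≡)
psym-fibre-count odd₃ (suc s) =
  HasCount-cong fibre (HasCount-⊎ distinct (HasCount-≡ (pseudoSymmetric₀ (suc s))) (HasCount-≡ (pseudoSymmetric₁ s)))
  where
  distinct : ∀ t → t ≡ pseudoSymmetric₀ (suc s) → t ≡ pseudoSymmetric₁ s → ⊥
  distinct t refl e = <-irrefl (cong x₁ (sym e)) (n<1+n (suc s))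
  select : ∀ {t} → Shape t → x₃ t ≡ suc s → t ≡ pseudoSymmetric₀ (suc s) ⊎ t ≡ pseudoSymmetric₁ s
  select (_ , inj₁ refl) refl = inj₁ refl
  select (_ , inj₂ refl) refl = inj₂ refl
  fibre : ∀ t → (t ≡ pseudoSymmetric₀ (suc s) ⊎ t ≡ pseudoSymmetric₁ s) ⇔
                ((Kunz t × PseudoSymmetricCoords t) × x₃ t ≡ suc s)
  fibre t = mk⇔ (λ where (inj₁ refl) → from (pseudoSymmetric-shape t) (suc s , inj₁ refl) , refl
                         (inj₂ refl) → from (pseudoSymmetric-shape t) (s , inj₂ refl) , refl)
                (λ (kp , z≡) → select (to (pseudoSymmetric-shape t) kp) z≡)

IsPsym4-∑ : ∀ {ρ} (o : Odd ρ) k → IsPsym4 (k * 4 + ⟦ ρ ⟧) (∑< (suc k) (psymFibreSize o))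
IsPsym4-∑ {ρ} o k =
  HasCount-encode (valid⇒withinBound o k)
    (λ t valid → pseudoSymmetric-encode {k * 4 + ⟦ ρ ⟧} (valid⇒withinBound o k t valid))
    (HasCount-cong (λ t → mk⇔ (λ ((kunz , psc) , c<1+k) → from (Valid⇔ k t) (kunz , c<1+k) , psc)
                              (λ (valid , psc) → let (kunz , c<1+k) = to (Valid⇔ k t) valid in (kunz , psc) , c<1+k))
      (HasCount-fibres (coord ρ) (suc k) (λ K _ → psym-fibre-count o K)))

data OddAbove4 : ℕ → Set where
  oddAbove4 : ∀ K {ρ} → Odd ρ → OddAbove4 (suc K * 4 + ⟦ ρ ⟧)

oddAbove4-view : ∀ q → q % 2 ≡ 1 → 4 < q → OddAbove4 q
oddAbove4-view q q%2≡1 4<q with mod4 q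
... | zero  ·4+ ρ  = contradiction 4<q (<-asym (⟦⟧<4 ρ))
... | suc K ·4+ r₀ = contradiction (trans (sym (·4+-%2 (suc K) 0)) q%2≡1) λ ()
... | suc K ·4+ r₁ = oddAbove4 K odd₁
... | suc K ·4+ r₂ = contradiction (trans (sym (·4+-%2 (suc K) 2)) q%2≡1) λ ()
... | suc K ·4+ r₃ = oddAbove4 K odd₃

mainTheorem13 : (∀ q → q % 2 ≡ 1 → 4 < q →
    ∃₂ λ a b → IsN4 q a × IsN4 (q ∸ 4) b ×
    (8 * a ≡ (q * q + 4 * q + 3)
    + 4 * (((q ∸ 1) / 6) + 1) * ((q ∸ 1) ∸ 3 * ((q ∸ 1) / 6))
    + 8 * b))
    × (∀ q → q % 2 ≡ 1 → 7 ≤ q →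
    ∃₂ λ a b → IsPsym4 q a × IsPsym4 (q ∸ 4) b × (a ≡ b + 2))
mainTheorem13 = N-recurrence , Psym-recurrence
  where
  N-recurrence : ∀ q → q % 2 ≡ 1 → 4 < q → ∃₂ λ a b → IsN4 q a × IsN4 (q ∸ 4) b × 8 * a ≡ Δ₈ q + 8 * b
  N-recurrence q q%2≡1 4<q with oddAbove4-view q q%2≡1 4<q
  ... | oddAbove4 K o = ∑< (2 + K) D , b , IsN4-∑ o (suc K) , IsN4-∑ o K , (begin
    8 * (b + D (suc K))        ≡⟨ *-distribˡ-+ 8 b (D (suc K)) ⟩
    8 * b + 8 * D (suc K)      ≡⟨ +-comm (8 * b) _ ⟩
    8 * D (suc K) + 8 * b      ≡⟨ cong (_+ 8 * b) (fibreSize-Δ₈ o (suc K)) ⟩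
    Δ₈ (suc K * 4 + _) + 8 * b ∎)
    where
    open ≡-Reasoning
    D : ℕ → ℕ
    D = fibreSize o
    b : ℕ
    b = ∑< (1 + K) D

  Psym-recurrence : ∀ q → q % 2 ≡ 1 → 7 ≤ q → ∃₂ λ a b → IsPsym4 q a × IsPsym4 (q ∸ 4) b × a ≡ b + 2
  Psym-recurrence q q%2≡1 7≤q with oddAbove4-view q q%2≡1 (≤-trans (m≤m+n 5 2) 7≤q)
  ... | oddAbove4 K o = _ , _ , IsPsym4-∑ o (suc K) , IsPsym4-∑ o K , refl
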